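{- In the persistent data structure described in the context, the amortized number of times a node at height $h+1$ of an ST-tree gains a third child following an insertion (a Write whose point lies in its subtree) is $O(1/2^h)$.
   Context: Model: an ephemeral structure manipulates a memory array $A$ with primitives Read$(i)$ (return $A[i]$) and Write$(i,x)$ (set $A[i]=x$). Writes are numbered $1,2,\dots$; $V$ is the number of Writes so far and $A_v$ the state of $A$ after the $v$-th Write. Persistent-Read$(v,i)$ returns $A_v[i]$. The $v$-th Write, Write$(i,x)$, is represented by the point $(i,v)$ labeled $x$ in the integer grid ($x$-axis memory address, $y$-axis time increasing upward); $P$ is the set of such points. ST-trees: each node has an axis-parallel grid rectangle, closed (four-sided) or open (unbounded upward). A node of height $h$ (leaves height $0$) has a rectangle of width $2^h$. Each internal node has a left and right child (half width, side by side) and possibly a third, upper child lying on top of one of them; children's rectangles partition the parent's. A leaf is full iff its rectangle contains a point of $P$; an internal node is full iff it has two full children; a node with three children has a full child; open rectangles are not full. Each leaf stores the at most one point of $P$ in its rectangle and the value $A_v[i]$ for the point $(i,v)$ at the bottom of its rectangle. Global structure: $U$ is the largest memory address written so far rounded up to a power of $2$. The structure keeps $\lceil V/U\rceil$ ST-trees whose root rectangles have width $U$: the $j$-th (bottom) tree has rectangle $[1..U]\times[(j-1)U+1..jU]$ and the last (top) tree has the open rectangle $[1..U]\times[(\lceil V/U\rceil-1)U+1..\infty)$. It also keeps a log of all Writes and an array $C$ of size $U$, where $C[i]$ holds the current $A[i]$ and a pointer to the leaf containing the highest point of $P$ in column $i$. Write$(i,x)$: if $i>U$, $U$ is doubled and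 everything is rebuilt by replaying the log; once every $U$ Writes, when the new point lies above the top tree's square, the top tree is compressed into a new bottom tree and a new top tree is created as a complete binary tree (only left/right children) with open rectangles and leaves filled from $C$. Then $C[i]=x$, $V$ is incremented, the point $(i,V)$ is stored in the leaf containing it (reached via $C$) and that leaf is marked full. Reconfiguration: while the parent of the current full node already has three children, the parent is marked full and becomes the current node. For the final node $q$ (whose parent has only two children), every open rectangle in $q$'s subtree is closed by setting its top side to $V$, and a third child is added to $q$'s parent: the root of a new complete binary tree of the same height as $q$, whose open rectangle lies directly on top of $q$'s rectangle and whose leaves are filled with the current values from $C$. -}

module Defs where

open import Data.Nat using (ℕ; zero; suc; _≟_)
open import Data.Bool using (Bool; true; false; if_then_else_)
open import Data.List using (List; []; _∷_; _++_; filter; length)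
open import Data.Vec using (Vec; []; _∷_)
open import Data.Product using (_×_; _,_)

-- Which lower child the upper (third) child is stacked on.
data Side : Set where
  onLeft onRight : Side

-- Column addresses of a
-- node of height h are encoded by h bits (false = left half, true = right
-- half, most significant first); the x-extent (width 2^h) is implicit in the
-- position of the node.  The y-extents are represented structurally: in a
-- node with three children, the child under the upper child is the closed
-- (stacked-over) one, and the point (i,V) of a new Write lies in the upper
-- child (if i is in that half) or in the other lower child.
data ST : ℕ → Set where
  -- leaf: is it full (does it contain a point of P)?
  leaf  : Bool → ST zero
  node2 : ∀ {h} → ST h → ST h → ST (suc h)
  -- node with three children: full-mark, side of the upper child,
  -- left child, right child, upper child
  node3 : ∀ {h} → Bool → Side → ST h → ST h → ST h → ST (suc h)

-- A new complete binary tree (only left/right children), with open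
-- rectangles and empty (non-full) leaves.  (The values A_v[i] copied from C
-- into the leaves do not affect the shape and are omitted.)
fresh : (h : ℕ) → ST h
fresh zero    = leaf false
fresh (suc h) = node2 (fresh h) (fresh h)

-- Result of inserting the point of a Write into a subtree:
-- new subtree, whether the subtree root is now (marked) full and must be
-- reported to its parent, and the list of heights of the nodes which gained a
-- third child during this insertion.
Result : ℕ → Set
Result h = ST h × Bool × List ℕ

-- A full node reported to a parent with two
-- children is the final node q: its subtree is closed (it is never entered
-- again) and the parent (of height suc h) gains a third child, a fresh tree
-- of the same height as q placed on top of q.
insert : ∀ {h} → Vec Bool h → ST h → Result h
insert [] (leaf _) = leaf true , true , []
insert {suc h} (false ∷ bs) (node2 l r) with insert bs l
... | l' , true  , g = node3 false onLeft l' r (fresh h) , false , suc h ∷ g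
... | l' , false , g = node2 l' r , false , g
insert {suc h} (true ∷ bs) (node2 l r) with insert bs r
... | r' , true  , g = node3 false onRight l r' (fresh h) , false , suc h ∷ g
... | r' , false , g = node2 l r' , false , g
insert (false ∷ bs) (node3 f onLeft l r u) with insert bs u
... | u' , true  , g = node3 true onLeft l r u' , true , g
... | u' , false , g = node3 f onLeft l r u' , false , g
insert (true ∷ bs) (node3 f onLeft l r u) with insert bs r
... | r' , true  , g = node3 true onLeft l r' u , true , g
... | r' , false , g = node3 f onLeft l r' u , false , g
insert (false ∷ bs) (node3 f onRight l r u) with insert bs l
... | l' , true  , g = node3 true onRight l' r u , true , g
... | l' , false , g = node3 f onRight l' r u , false , g
insert (true ∷ bs) (node3 f onRight l r u) with insert bs u
... | u' , true  , g = node3 true onRight l r u' , true , g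
... | u' , false , g = node3 f onRight l r u' , false , g

run : ∀ {H} → ST H → List (Vec Bool H) → ST H × List ℕ
run t []       = t , []
run t (w ∷ ws) with insert w t
... | t' , _ , g with run t' ws
...   | t'' , g' = t'' , g ++ g'

gainsAt : (H k : ℕ) → List (Vec Bool H) → ℕ
gainsAt H k ws with run (fresh H) ws
... | _ , g = length (filter (_≟ k) g)

-- A node of height h+1 gains a third child only when one of its lower children
-- becomes full, and a full node of height h holds at least 2^h points of P.
-- That child is closed at that moment and stays covered by the third child
-- forever, so its 2^h points are charged to this gain alone.  Since every
-- Write adds at most one point, (number of gains at height h+1) * 2^h is at
-- most the number of Writes.
module Submission where

open import Defs
open import Data.Nat using (ℕ; suc; _*_; _^_; _≤_)
open import Data.List using (List; length)
open import Data.Vec using (Vec)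
open import Data.Bool using (Bool)
open import Data.Product using (∃-syntax)

open import Data.Nat using (zero; _+_; _<_; _≟_; z≤n)
open import Data.Nat.Properties
open import Data.List using ([]; _∷_; [_]; _++_; filter)
open import Data.List.Properties using (length-++; filter-++)
open import Data.Vec using ([]; _∷_)
open import Data.Bool using (true; false)
open import Data.Product using (_×_; _,_)
open import Data.Unit using (⊤; tt)
open import Function using (_∘_)
open import Relation.Nullary using (yes; no)
open import Relation.Nullary.Decidable using (dec-true; dec-false)
open import Relation.Binary.PropositionalEquality using (_≡_; _≢_; refl; sym; trans; cong; subst; module ≡-Reasoning)

multiplicity : ℕ → List ℕ → ℕ
multiplicity k xs = length (filter (_≟ k) xs)

multiplicity-++ : ∀ k xs ys → multiplicity k (xs ++ ys) ≡ multiplicity k xs + multiplicity k ys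
multiplicity-++ k xs ys = trans (cong length (filter-++ (_≟ k) xs ys)) (length-++ (filter (_≟ k) xs))

multiplicity-self : ∀ k → multiplicity k [ k ] ≡ 1
multiplicity-self k rewrite dec-true (k ≟ k) refl = refl

multiplicity-other : ∀ {x k} → x ≢ k → multiplicity k [ x ] ≡ 0
multiplicity-other {x} {k} x≢k rewrite dec-false (x ≟ k) x≢k = refl

points : ∀ {n} → ST n → ℕ
points (leaf false)      = 0
points (leaf true)       = 1
points (node2 l r)       = points l + points r
points (node3 _ _ l r u) = points l + points r + points u

thirdsAt : ℕ → ∀ {n} → ST n → ℕ
thirdsAt k (leaf _)              = 0
thirdsAt k (node2 l r)           = thirdsAt k l + thirdsAt k r
thirdsAt k (node3 {h} _ _ l r u) =
  multiplicity k [ suc h ] + (thirdsAt k l + thirdsAt k r + thirdsAt k u)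

covered : ∀ {h} → Side → ST h → ST h → ST h
covered onLeft  l _ = l
covered onRight _ r = r

Dense : ∀ {n} → ST n → Set
Dense (leaf _)              = ⊤
Dense (node2 l r)           = Dense l × Dense r
Dense (node3 {h} _ s l r u) = Dense l × Dense r × Dense u × 2 ^ h ≤ points (covered s l r)

points-fresh : ∀ h → points (fresh h) ≡ 0
points-fresh zero    = refl
points-fresh (suc h) rewrite points-fresh h = refl

thirdsAt-fresh : ∀ k h → thirdsAt k (fresh h) ≡ 0
thirdsAt-fresh k zero    = refl
thirdsAt-fresh k (suc h) rewrite thirdsAt-fresh k h = refl

dense-fresh : ∀ h → Dense (fresh h)
dense-fresh zero    = tt
dense-fresh (suc h) = dense-fresh h , dense-fresh h

covered+upper≤points : ∀ {h} s (l r u : ST h) →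
                       points (covered s l r) + points u ≤ points l + points r + points u
covered+upper≤points onLeft  l r u = +-monoˡ-≤ (points u) (m≤m+n (points l) (points r))
covered+upper≤points onRight l r u = +-monoˡ-≤ (points u) (m≤n+m (points r) (points l))

+-vanishʳ : ∀ x {y} → y ≡ 0 → x + y ≡ x
+-vanishʳ x refl = +-identityʳ x

absorbˡ : ∀ a {x x'} y → a + x ≡ x' → a + (x + y) ≡ x' + y
absorbˡ a {x} y e = trans (sym (+-assoc a x y)) (cong (_+ y) e)

absorbʳ : ∀ a {x x'} y → a + x ≡ x' → a + (y + x) ≡ y + x'
absorbʳ a {x} {x'} y e = begin
  a + (y + x) ≡⟨ sym (+-assoc a y x) ⟩
  a + y + x   ≡⟨ cong (_+ x) (+-comm a y) ⟩
  y + a + x   ≡⟨ +-assoc y a x ⟩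
  y + (a + x) ≡⟨ cong (y +_) e ⟩
  y + x'      ∎
  where open ≡-Reasoning

sucˡ : ∀ {x x'} y → x' ≤ suc x → x' + y ≤ suc (x + y)
sucˡ y = +-monoˡ-≤ y

sucʳ : ∀ {x x'} y → x' ≤ suc x → y + x' ≤ suc (y + x)
sucʳ {x} y p = ≤-trans (+-monoʳ-≤ y p) (≤-reflexive (+-suc y x))

double-≤ : ∀ h {x y z} → 2 ^ h ≤ x → 2 ^ h ≤ y → x + y ≤ z → 2 ^ suc h ≤ z
double-≤ h p q s =
  ≤-trans (≤-reflexive (cong (2 ^ h +_) (+-identityʳ (2 ^ h)))) (≤-trans (+-mono-≤ p q) s)

multiplicity-∷-absorb : ∀ k x g {n n'} → multiplicity k g + n ≡ n' →
              multiplicity k (x ∷ g) + n ≡ multiplicity k [ x ] + n'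
multiplicity-∷-absorb k x g {n} e =
  trans (cong (_+ n) (multiplicity-++ k [ x ] g))
        (trans (+-assoc (multiplicity k [ x ]) (multiplicity k g) n) (cong (multiplicity k [ x ] +_) e))

record InsertSpec {n} (t t' : ST n) (reported : Bool) (gained : List ℕ) : Set where
  field
    dense    : Dense t'
    points-≤ : points t' ≤ suc (points t)
    full     : reported ≡ true → 2 ^ n ≤ points t'
    thirds   : ∀ k → multiplicity k gained + thirdsAt k t ≡ thirdsAt k t'
open InsertSpec

Inserts : ∀ {n} → ST n → Result n → Set
Inserts t (t' , reported , gained) = InsertSpec t t' reported gained

descend-left : ∀ {h} {l l' r : ST h} {g} →
               InsertSpec l l' false g → Dense r → InsertSpec (node2 l r) (node2 l' r) false g
descend-left {r = r} {g} G dr = record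
  { dense    = dense G , dr
  ; points-≤ = sucˡ (points r) (points-≤ G)
  ; full     = λ ()
  ; thirds   = λ k → absorbˡ (multiplicity k g) (thirdsAt k r) (thirds G k) }

descend-right : ∀ {h} {l r r' : ST h} {g} →
                Dense l → InsertSpec r r' false g → InsertSpec (node2 l r) (node2 l r') false g
descend-right {l = l} {g = g} dl G = record
  { dense    = dl , dense G
  ; points-≤ = sucʳ (points l) (points-≤ G)
  ; full     = λ ()
  ; thirds   = λ k → absorbʳ (multiplicity k g) (thirdsAt k l) (thirds G k) }

close-left : ∀ {h} {l l' r : ST h} {g} →
             InsertSpec l l' true g → Dense r →
             InsertSpec (node2 l r) (node3 false onLeft l' r (fresh h)) false (suc h ∷ g)
close-left {h} {l' = l'} {r} {g} G dr = record
  { dense    = dense G , dr , dense-fresh h , full G refl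
  ; points-≤ = ≤-trans (≤-reflexive (+-vanishʳ (points l' + points r) (points-fresh h)))
                       (sucˡ (points r) (points-≤ G))
  ; full     = λ ()
  ; thirds   = λ k → multiplicity-∷-absorb k (suc h) g
      (trans (absorbˡ (multiplicity k g) (thirdsAt k r) (thirds G k))
             (sym (+-vanishʳ (thirdsAt k l' + thirdsAt k r) (thirdsAt-fresh k h)))) }

close-right : ∀ {h} {l r r' : ST h} {g} →
              Dense l → InsertSpec r r' true g →
              InsertSpec (node2 l r) (node3 false onRight l r' (fresh h)) false (suc h ∷ g)
close-right {h} {l} {r' = r'} {g} dl G = record
  { dense    = dl , dense G , dense-fresh h , full G refl
  ; points-≤ = ≤-trans (≤-reflexive (+-vanishʳ (points l + points r') (points-fresh h)))
                       (sucʳ (points l) (points-≤ G))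
  ; full     = λ ()
  ; thirds   = λ k → multiplicity-∷-absorb k (suc h) g
      (trans (absorbʳ (multiplicity k g) (thirdsAt k l) (thirds G k))
             (sym (+-vanishʳ (thirdsAt k l + thirdsAt k r') (thirdsAt-fresh k h)))) }

descend-upper : ∀ {h} {f f' s} {l r u u' : ST h} {reported g} →
                Dense l → Dense r → 2 ^ h ≤ points (covered s l r) →
                InsertSpec u u' reported g →
                InsertSpec (node3 f s l r u) (node3 f' s l r u') reported g
descend-upper {h} {s = s} {l} {r} {u' = u'} {g = g} dl dr c G = record
  { dense    = dl , dr , dense G , c
  ; points-≤ = sucʳ (points l + points r) (points-≤ G)
  ; full     = λ rep → double-≤ h c (full G rep) (covered+upper≤points s l r u')
  ; thirds   = λ k → let a = multiplicity k g; i = multiplicity k [ suc h ] in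
      absorbʳ a i (absorbʳ a (thirdsAt k l + thirdsAt k r) (thirds G k)) }

descend-right-under : ∀ {h} {f f'} {l r u r' : ST h} {reported g} →
                      Dense l → 2 ^ h ≤ points l → Dense u →
                      InsertSpec r r' reported g →
                      InsertSpec (node3 f onLeft l r u) (node3 f' onLeft l r' u) reported g
descend-right-under {h} {l = l} {u = u} {r'} {g = g} dl c du G = record
  { dense    = dl , dense G , du , c
  ; points-≤ = sucˡ (points u) (sucʳ (points l) (points-≤ G))
  ; full     = λ rep → double-≤ h c (full G rep) (m≤m+n (points l + points r') (points u))
  ; thirds   = λ k → let a = multiplicity k g; i = multiplicity k [ suc h ] in
      absorbʳ a i (absorbˡ a (thirdsAt k u) (absorbʳ a (thirdsAt k l) (thirds G k))) }

descend-left-under : ∀ {h} {f f'} {l r u l' : ST h} {reported g} →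
                     Dense r → 2 ^ h ≤ points r → Dense u →
                     InsertSpec l l' reported g →
                     InsertSpec (node3 f onRight l r u) (node3 f' onRight l' r u) reported g
descend-left-under {h} {r = r} {u} {l'} {g = g} dr c du G = record
  { dense    = dense G , dr , du , c
  ; points-≤ = sucˡ (points u) (sucˡ (points r) (points-≤ G))
  ; full     = λ rep → double-≤ h (full G rep) c (m≤m+n (points l' + points r) (points u))
  ; thirds   = λ k → let a = multiplicity k g; i = multiplicity k [ suc h ] in
      absorbʳ a i (absorbˡ a (thirdsAt k u) (absorbˡ a (thirdsAt k r) (thirds G k))) }

insert-spec : ∀ {n} (bs : Vec Bool n) (t : ST n) → Dense t → Inserts t (insert bs t)
insert-spec [] (leaf false) _ = record
  { dense = tt ; points-≤ = ≤-refl ; full = λ _ → ≤-refl ; thirds = λ _ → refl }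
insert-spec [] (leaf true) _ = record
  { dense = tt ; points-≤ = n≤1+n 1 ; full = λ _ → ≤-refl ; thirds = λ _ → refl }
insert-spec (false ∷ bs) (node2 l r) (dl , dr) with insert bs l | insert-spec bs l dl
... | _ , true  , _ | G = close-left G dr
... | _ , false , _ | G = descend-left G dr
insert-spec (true ∷ bs) (node2 l r) (dl , dr) with insert bs r | insert-spec bs r dr
... | _ , true  , _ | G = close-right dl G
... | _ , false , _ | G = descend-right dl G
insert-spec (false ∷ bs) (node3 f onLeft l r u) (dl , dr , du , c) with insert bs u | insert-spec bs u du
... | _ , true  , _ | G = descend-upper dl dr c G
... | _ , false , _ | G = descend-upper dl dr c G
insert-spec (true ∷ bs) (node3 f onLeft l r u) (dl , dr , du , c) with insert bs r | insert-spec bs r dr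
... | _ , true  , _ | G = descend-right-under dl c du G
... | _ , false , _ | G = descend-right-under dl c du G
insert-spec (false ∷ bs) (node3 f onRight l r u) (dl , dr , du , c) with insert bs l | insert-spec bs l dl
... | _ , true  , _ | G = descend-left-under dr c du G
... | _ , false , _ | G = descend-left-under dr c du G
insert-spec (true ∷ bs) (node3 f onRight l r u) (dl , dr , du , c) with insert bs u | insert-spec bs u du
... | _ , true  , _ | G = descend-upper dl dr c G
... | _ , false , _ | G = descend-upper dl dr c G

Runs : ∀ {H} → ST H → List (Vec Bool H) → ST H × List ℕ → Set
Runs t ws (t' , gained) =
  Dense t' × points t' ≤ points t + length ws ×
  (∀ k → multiplicity k gained + thirdsAt k t ≡ thirdsAt k t')

run-spec : ∀ {H} (t : ST H) ws → Dense t → Runs t ws (run t ws)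
run-spec t [] d = d , ≤-reflexive (sym (+-identityʳ (points t))) , λ _ → refl
run-spec t (w ∷ ws) d with insert w t | insert-spec w t d
... | t' , _ , g | G with run t' ws | run-spec t' ws (dense G)
... | t'' , g' | d'' , points≤ , thirds'' = d'' , points≤′ , thirds′
  where
    points≤′ : points t'' ≤ points t + suc (length ws)
    points≤′ = ≤-trans points≤
      (≤-trans (+-monoˡ-≤ (length ws) (points-≤ G)) (≤-reflexive (sym (+-suc (points t) (length ws)))))
    thirds′ : ∀ k → multiplicity k (g ++ g') + thirdsAt k t ≡ thirdsAt k t''
    thirds′ k = begin
      multiplicity k (g ++ g') + thirdsAt k t                  ≡⟨ cong (_+ thirdsAt k t) (multiplicity-++ k g g') ⟩
      multiplicity k g + multiplicity k g' + thirdsAt k t      ≡⟨ cong (_+ thirdsAt k t) (+-comm (multiplicity k g) _) ⟩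
      multiplicity k g' + multiplicity k g + thirdsAt k t      ≡⟨ +-assoc (multiplicity k g') _ _ ⟩
      multiplicity k g' + (multiplicity k g + thirdsAt k t)    ≡⟨ cong (multiplicity k g' +_) (thirds G k) ⟩
      multiplicity k g' + thirdsAt k t'                        ≡⟨ thirds'' k ⟩
      thirdsAt k t''                                           ∎
      where open ≡-Reasoning

thirdsAt-above : ∀ k {n} (t : ST n) → n < k → thirdsAt k t ≡ 0
thirdsAt-above k (leaf _) _ = refl
thirdsAt-above k (node2 l r) n<k
  rewrite thirdsAt-above k l (<⇒≤ n<k) | thirdsAt-above k r (<⇒≤ n<k) = refl
thirdsAt-above k (node3 _ _ l r u) n<k
  rewrite multiplicity-other (<⇒≢ n<k)
        | thirdsAt-above k l (<⇒≤ n<k) | thirdsAt-above k r (<⇒≤ n<k) | thirdsAt-above k u (<⇒≤ n<k) = refl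

*-+-≤ : ∀ c {x y a b} → c * x ≤ a → c * y ≤ b → c * (x + y) ≤ a + b
*-+-≤ c {x} {y} p q = ≤-trans (≤-reflexive (*-distribˡ-+ c x y)) (+-mono-≤ p q)

thirdsAt-bound : ∀ h {n} (t : ST n) → Dense t → 2 ^ h * thirdsAt (suc h) t ≤ points t
thirdsAt-bound h (leaf _) _ = ≤-trans (≤-reflexive (*-zeroʳ (2 ^ h))) z≤n
thirdsAt-bound h (node2 l r) (dl , dr) =
  *-+-≤ (2 ^ h) (thirdsAt-bound h l dl) (thirdsAt-bound h r dr)
thirdsAt-bound h (node3 {m} _ s l r u) (dl , dr , du , c) with m ≟ h
... | yes refl
  rewrite multiplicity-self (suc m)
        | thirdsAt-above (suc m) l (n<1+n m) | thirdsAt-above (suc m) r (n<1+n m)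
        | thirdsAt-above (suc m) u (n<1+n m) =
  ≤-trans (≤-reflexive (*-identityʳ (2 ^ m)))
    (≤-trans c (≤-trans (m≤m+n _ (points u)) (covered+upper≤points s l r u)))
... | no m≢h rewrite multiplicity-other {suc m} {suc h} (m≢h ∘ suc-injective) =
  *-+-≤ (2 ^ h) (*-+-≤ (2 ^ h) (thirdsAt-bound h l dl) (thirdsAt-bound h r dr)) (thirdsAt-bound h u du)

gainsAt-bound : ∀ H h (ws : List (Vec Bool H)) → gainsAt H (suc h) ws * 2 ^ h ≤ length ws
gainsAt-bound H h ws with run (fresh H) ws | run-spec (fresh H) ws (dense-fresh H)
... | t , g | d , points≤ , thirds = begin
  multiplicity (suc h) g * 2 ^ h  ≡⟨ cong (_* 2 ^ h) gains≡thirds ⟩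
  thirdsAt (suc h) t * 2 ^ h      ≡⟨ *-comm (thirdsAt (suc h) t) (2 ^ h) ⟩
  2 ^ h * thirdsAt (suc h) t      ≤⟨ thirdsAt-bound h t d ⟩
  points t                        ≤⟨ points≤ ⟩
  points (fresh H) + length ws    ≡⟨ cong (_+ length ws) (points-fresh H) ⟩
  length ws                       ∎
  where
    open ≤-Reasoning
    gains≡thirds : multiplicity (suc h) g ≡ thirdsAt (suc h) t
    gains≡thirds = trans (sym (+-vanishʳ _ (thirdsAt-fresh (suc h) H))) (thirds (suc h))

-- The bound holds for any number of Writes.
lemma3 : ∃[ c ] ∀ (H h : ℕ) (ws : List (Vec Bool H)) → length ws ≤ 2 ^ H →
           gainsAt H (suc h) ws * 2 ^ h ≤ c * length ws
lemma3 = 1 , λ H h ws _ →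
  subst (gainsAt H (suc h) ws * 2 ^ h ≤_) (sym (*-identityˡ (length ws))) (gainsAt-bound H h ws)
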